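{- Let $T'$ be a tree with a unique maximum open packing and with $\Delta(T')\ge 3$, and let $x$ be a leaf in $L(T')$. Suppose there are two paths $x,a,b,c$ and $x,a',b',c'$ in $T'$, where $\deg_{T'}(a)=\deg_{T'}(a')=\deg_{T'}(b)=\deg_{T'}(b')=2$ and $\deg_{T'}(c)=\deg_{T'}(c')=1$. Let $T_1=T'-\{a,b,c\}$ and $T=T'-\{a,b,c,a',b',c'\}$. Then at least one of the trees $T,T_1$ has a unique maximum open packing. In addition, $T'$ is obtainable from $T$ by Operation 3 at $x$, or $T'$ is obtainable from $T_1$ by Operation 2 at $x$. Here, for a graph $G$ with a unique maximum open packing $U(G)$ and a vertex $w$: Operation 2 at $w$ is allowed when $w\notin U(G)$ but some neighbor of $w$ is in $U(G)$, and consists of appending a $P_3$ to $w$; Operation 3 at $w$ is allowed when $w\in U(G)$, some neighbor of $w$ belongs to $U(G)$, and there is exactly one open packing of $G$ of size $\rho^{\rm o}(G)-1$ not containing $w$, and consists of appending two $P_3$'s to $w$.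
   Context: An open packing in a graph is a set of vertices whose open neighborhoods are pairwise disjoint; $\rho^{\rm o}(G)$ is the maximum cardinality of an open packing. Appending a $P_3$ to a vertex $w$ means adding a new path on 3 vertices and joining $w$ to one of its end vertices. For a tree $T'$ with maximum degree $\Delta(T')\ge 3$, $L(T')$ is the tree whose vertices are the vertices of $T'$ of degree at least 3, two such vertices $p,q$ being adjacent in $L(T')$ if all internal vertices of the unique $p$–$q$ path in $T'$ have degree 2 in $T'$. -}

module Defs where

open import Data.Nat using (ℕ; _≤_; _∸_)
open import Data.Fin using (Fin)
open import Data.Fin.Subset using (Subset; _∈_; _∉_; _⊆_; ⁅_⁆; _∪_; _-_; ∣_∣)
open import Data.Bool using (Bool; _∧_)
open import Data.Vec using (lookup; tabulate)
open import Data.List using (List; []; _∷_; _++_; length)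
open import Data.List.Relation.Unary.All using (All)
open import Data.List.Relation.Unary.Linked using (Linked)
open import Data.List.Relation.Unary.Unique.Propositional using (Unique)
open import Data.Product using (Σ; _×_; ∃; ∃-syntax)
open import Data.Sum using (_⊎_)
open import Relation.Nullary using (¬_; Dec)
open import Relation.Nullary.Decidable using (isYes)
open import Relation.Binary.PropositionalEquality using (_≡_; _≢_)

record SimpleGraph (n : ℕ) : Set₁ where
  field
    Adj    : Fin n → Fin n → Set
    adj?   : ∀ u v → Dec (Adj u v)
    sym    : ∀ {u v} → Adj u v → Adj v u
    irrefl : ∀ {u} → ¬ Adj u u
open SimpleGraph public

-- Throughout, a graph is the subgraph of an ambient simple graph G induced by a
-- vertex set V : Subset n.  All notions below are relative to G[V].

module _ {n : ℕ} (G : SimpleGraph n) where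

  nbhd : Subset n → Fin n → Subset n
  nbhd V v = tabulate (λ u → lookup V u ∧ isYes (adj? G v u))

  deg : Subset n → Fin n → ℕ
  deg V v = ∣ nbhd V v ∣

  MaxDeg≥3 : Subset n → Set
  MaxDeg≥3 V = ∃[ v ] (v ∈ V × 3 ≤ deg V v)

  Connected : Subset n → Set
  Connected V = ∀ u v → u ∈ V → v ∈ V →
    (u ≡ v) ⊎ (∃[ xs ] (All (_∈ V) xs × Linked (Adj G) (u ∷ xs ++ v ∷ [])))

  HasCycle : Subset n → Set
  HasCycle V = ∃[ v0 ] ∃[ xs ]
    (v0 ∈ V × All (_∈ V) xs × 2 ≤ length xs × Unique (v0 ∷ xs)
      × Linked (Adj G) (v0 ∷ xs ++ v0 ∷ []))

  IsTree : Subset n → Set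
  IsTree V = (∃[ v ] v ∈ V) × Connected V × ¬ HasCycle V

  IsOpenPacking : Subset n → Subset n → Set
  IsOpenPacking V S = S ⊆ V ×
    (∀ u v → u ∈ S → v ∈ S → u ≢ v → ∀ w → w ∈ V → ¬ (Adj G u w × Adj G v w))

  IsMaxOpenPacking : Subset n → Subset n → Set
  IsMaxOpenPacking V S = IsOpenPacking V S × (∀ S' → IsOpenPacking V S' → ∣ S' ∣ ≤ ∣ S ∣)

  IsUniqueMaxOP : Subset n → Subset n → Set
  IsUniqueMaxOP V U = IsMaxOpenPacking V U × (∀ S → IsMaxOpenPacking V S → S ≡ U)

  HasUniqueMaxOP : Subset n → Set
  HasUniqueMaxOP V = ∃[ U ] IsUniqueMaxOP V U

  -- adjacency in L(G[V]): p,q distinct of degree ≥ 3 joined by a path all of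
  -- whose internal vertices have degree 2
  LAdj : Subset n → Fin n → Fin n → Set
  LAdj V p q = p ∈ V × q ∈ V × 3 ≤ deg V p × 3 ≤ deg V q × p ≢ q ×
    ∃[ xs ] (All (_∈ V) xs × All (λ y → deg V y ≡ 2) xs
             × Unique (p ∷ xs ++ q ∷ []) × Linked (Adj G) (p ∷ xs ++ q ∷ []))

  IsLeafOfL : Subset n → Fin n → Set
  IsLeafOfL V x = x ∈ V × 3 ≤ deg V x ×
    ∃[ q ] (LAdj V x q × (∀ q' → LAdj V x q' → q' ≡ q))

  AppendP3 : Subset n → Fin n → Subset n → Set
  AppendP3 V w V₂ = ∃[ p ] ∃[ q ] ∃[ r ]
    (w ∈ V × p ∉ V × q ∉ V × r ∉ V × p ≢ q × q ≢ r × p ≢ r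
     × V₂ ≡ V ∪ ⁅ p ⁆ ∪ ⁅ q ⁆ ∪ ⁅ r ⁆
     × Adj G w p × Adj G p q × Adj G q r × ¬ Adj G p r
     × (∀ u → u ∈ V → u ≢ w → ¬ Adj G u p)
     × (∀ u → u ∈ V → ¬ Adj G u q)
     × (∀ u → u ∈ V → ¬ Adj G u r))

  AppendTwoP3 : Subset n → Fin n → Subset n → Set
  AppendTwoP3 V w V₂ = ∃[ Vm ] (AppendP3 V w Vm × AppendP3 Vm w V₂)

  Operation2 : Subset n → Fin n → Subset n → Set
  Operation2 V w V₂ = ∃[ U ] (IsUniqueMaxOP V U × w ∉ U
    × (∃[ u ] (u ∈ V × Adj G w u × u ∈ U)) × AppendP3 V w V₂)

  ExactlyOneOPMinusOne : Subset n → Subset n → Fin n → Set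
  ExactlyOneOPMinusOne V U w = ∃[ S ] ((IsOpenPacking V S × ∣ S ∣ ≡ ∣ U ∣ ∸ 1 × w ∉ S)
    × (∀ S' → IsOpenPacking V S' → ∣ S' ∣ ≡ ∣ U ∣ ∸ 1 → w ∉ S' → S' ≡ S))

  Operation3 : Subset n → Fin n → Subset n → Set
  Operation3 V w V₂ = ∃[ U ] (IsUniqueMaxOP V U × w ∈ U
    × (∃[ u ] (u ∈ V × Adj G w u × u ∈ U))
    × ExactlyOneOPMinusOne V U w × AppendTwoP3 V w V₂)

module Submission where

-- The proof is organised around packings avoiding x.  Say R is the
-- unique largest x-free open packing of G[W] if every open packing of
-- G[W] missing x is at most as large as R, and equally large only when it
-- is R.  For one pendant path a–b–c inside W we show:
--   * such an R contains b and c but not a, and R - b - c is the unique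
--     largest x-free packing of W - a - b - c (restriction);
--   * R contains a neighbour of x (otherwise swap c for a);
--   * any packing containing x can be traded, by replacing x and a with
--     b and c, for an x-free packing that is no smaller; hence either R is
--     the unique maximum open packing of G[W], or (R - b - c) ∪ {x} is an
--     open packing of W - a - b - c (dichotomy).
-- With two pendant paths, a maximum packing U of G[V] avoids x (otherwise
-- trade x for b and b').  Restricting U twice gives U₁ = U - b - c on T₁ and
-- S₀ = U₁ - b' - c' on T.  The dichotomy for the second path then yields
-- Operation 2 (U₁ unique in T₁) or Operation 3 (S₀ ∪ {x} unique in T).

open import Data.Nat using (ℕ; suc; _+_; _≤_; _∸_; s≤s; s≤s⁻¹)
open import Data.Nat.Properties using (≤-reflexive; ≤-trans; n≤1+n; 1+n≰n; <⇒≱; module ≤-Reasoning)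
open import Data.Bool using (_∧_)
open import Data.Fin using (Fin; zero; suc; _≟_)
open import Data.Fin.Properties using (all?; any?)
open import Data.Fin.Subset using (Subset; inside; outside; _∈_; _∉_; _⊆_; ⁅_⁆; _∪_; _-_; ∣_∣)
open import Data.Fin.Subset.Properties
  using (_∈?_; _⊆?_; x∈⁅x⁆; x∈⁅y⁆⇒x≡y; x∈p∪q⁺; x∈p∪q⁻; p─q⊆p; x∈p∧x≢y⇒x∈p-y; ⊆-antisym; ∪-identityʳ;
         p⊆q⇒∣p∣≤∣q∣; ∣p∣≤∣p∪q∣)
open import Data.Vec using (_∷_)
open import Data.Vec.Base using (here; there)
open import Data.Vec.Properties using (lookup∘tabulate; lookup⇒[]=; []=⇒lookup)
open import Data.Product using (∃-syntax; _×_; _,_; proj₁; proj₂)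
open import Data.Sum using (_⊎_; inj₁; inj₂; [_,_]′)
open import Data.Empty using (⊥; ⊥-elim)
open import Relation.Nullary using (¬_; Dec; yes; no)
open import Relation.Nullary.Decidable using (_×-dec_; _→-dec_; ¬?; isYes≗does; dec-true)
open import Relation.Binary.PropositionalEquality
  using (_≡_; _≢_; refl; sym; trans; cong; cong₂; subst; subst₂; module ≡-Reasoning)
open import Function using (_∘_; id; case_of_)
open import Defs renaming (sym to adj-sym; irrefl to adj-irrefl)

infixl 5 _⊕_
_⊕_ : ∀ {n} → Subset n → Fin n → Subset n
p ⊕ x = p ∪ ⁅ x ⁆

x∉p-x : ∀ {n} (p : Subset n) x → x ∉ p - x
x∉p-x (inside ∷ p) zero ()
x∉p-x (outside ∷ p) zero ()
x∉p-x (s ∷ p) (suc x) (there h) = x∉p-x p x h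

card-⊕ : ∀ {n} (p : Subset n) {x} → x ∉ p → ∣ p ⊕ x ∣ ≡ suc ∣ p ∣
card-⊕ (inside ∷ p) {zero} x∉p = ⊥-elim (x∉p here)
card-⊕ (outside ∷ p) {zero} _ = cong (suc ∘ ∣_∣) (∪-identityʳ p)
card-⊕ (inside ∷ p) {suc x} x∉p = cong suc (card-⊕ p (x∉p ∘ there))
card-⊕ (outside ∷ p) {suc x} x∉p = card-⊕ p (x∉p ∘ there)

module _ {n : ℕ} where

  ∈-minus⁻ : ∀ {p : Subset n} {x y} → x ∈ p - y → x ∈ p
  ∈-minus⁻ {p} {y = y} = p─q⊆p p ⁅ y ⁆

  ∈-minus-≢ : ∀ {p : Subset n} {x y} → x ∈ p - y → x ≢ y
  ∈-minus-≢ {p} {x} h refl = x∉p-x p x h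

  ∈-minus⁺ : ∀ {p : Subset n} {x y} → x ∈ p → x ≢ y → x ∈ p - y
  ∈-minus⁺ = x∈p∧x≢y⇒x∈p-y

  ∈-⊕⁻ : ∀ {p : Subset n} {x y} → x ∈ p ⊕ y → x ∈ p ⊎ x ≡ y
  ∈-⊕⁻ {p} {y = y} h with x∈p∪q⁻ p ⁅ y ⁆ h
  ... | inj₁ x∈p = inj₁ x∈p
  ... | inj₂ x∈y = inj₂ (x∈⁅y⁆⇒x≡y y x∈y)

  ∈-⊕ˡ : ∀ {p : Subset n} {x y} → x ∈ p → x ∈ p ⊕ y
  ∈-⊕ˡ h = x∈p∪q⁺ (inj₁ h)

  ∈-⊕ʳ : ∀ {p : Subset n} {y} → y ∈ p ⊕ y
  ∈-⊕ʳ {y = y} = x∈p∪q⁺ (inj₂ (x∈⁅x⁆ y))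

  ∉-⊕ : ∀ {p : Subset n} {x y} → x ∉ p → x ≢ y → x ∉ p ⊕ y
  ∉-⊕ x∉p x≢y h = [ x∉p , x≢y ]′ (∈-⊕⁻ h)

  ∈-minus₃⁺ : ∀ {p : Subset n} {v a b c} → v ∈ p → v ≢ a → v ≢ b → v ≢ c → v ∈ p - a - b - c
  ∈-minus₃⁺ v∈p v≢a v≢b v≢c = ∈-minus⁺ (∈-minus⁺ (∈-minus⁺ v∈p v≢a) v≢b) v≢c

  ∈-minus₃⁻ : ∀ {p : Subset n} {v a b c} → v ∈ p - a - b - c → v ∈ p × v ≢ a × v ≢ b × v ≢ c
  ∈-minus₃⁻ h = ∈-minus⁻ (∈-minus⁻ (∈-minus⁻ h)) , ∈-minus-≢ (∈-minus⁻ (∈-minus⁻ h))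
              , ∈-minus-≢ (∈-minus⁻ h) , ∈-minus-≢ h

  minus₃-cases : ∀ {p : Subset n} {v} a b c → v ∈ p → v ∈ p - a - b - c ⊎ v ≡ a ⊎ v ≡ b ⊎ v ≡ c
  minus₃-cases {v = v} a b c v∈p with v ≟ a | v ≟ b | v ≟ c
  ... | yes v≡a | _ | _ = inj₂ (inj₁ v≡a)
  ... | no _ | yes v≡b | _ = inj₂ (inj₂ (inj₁ v≡b))
  ... | no _ | no _ | yes v≡c = inj₂ (inj₂ (inj₂ v≡c))
  ... | no v≢a | no v≢b | no v≢c = inj₁ (∈-minus₃⁺ v∈p v≢a v≢b v≢c)

  split₃ : ∀ {p : Subset n} {a b c} → a ∈ p → b ∈ p → c ∈ p →
    p ≡ (p - a - b - c) ∪ ⁅ a ⁆ ∪ ⁅ b ⁆ ∪ ⁅ c ⁆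
  split₃ {p} {a} {b} {c} a∈p b∈p c∈p = ⊆-antisym into onto
    where
    in-rest : ∀ {v} → v ∈ ⁅ a ⁆ ∪ ⁅ b ⁆ ∪ ⁅ c ⁆ → v ∈ p
    in-rest h with x∈p∪q⁻ ⁅ a ⁆ _ h
    ... | inj₁ v∈a rewrite x∈⁅y⁆⇒x≡y a v∈a = a∈p
    ... | inj₂ h′ with x∈p∪q⁻ ⁅ b ⁆ ⁅ c ⁆ h′
    ... | inj₁ v∈b rewrite x∈⁅y⁆⇒x≡y b v∈b = b∈p
    ... | inj₂ v∈c rewrite x∈⁅y⁆⇒x≡y c v∈c = c∈p
    onto : (p - a - b - c) ∪ ⁅ a ⁆ ∪ ⁅ b ⁆ ∪ ⁅ c ⁆ ⊆ p
    onto h = [ proj₁ ∘ ∈-minus₃⁻ , in-rest ]′ (x∈p∪q⁻ (p - a - b - c) _ h)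
    into : p ⊆ (p - a - b - c) ∪ ⁅ a ⁆ ∪ ⁅ b ⁆ ∪ ⁅ c ⁆
    into v∈p with minus₃-cases a b c v∈p
    ... | inj₁ h = x∈p∪q⁺ (inj₁ h)
    ... | inj₂ (inj₁ refl) = x∈p∪q⁺ (inj₂ (x∈p∪q⁺ (inj₁ (x∈⁅x⁆ a))))
    ... | inj₂ (inj₂ (inj₁ refl)) = x∈p∪q⁺ (inj₂ (x∈p∪q⁺ (inj₂ (x∈p∪q⁺ (inj₁ (x∈⁅x⁆ b))))))
    ... | inj₂ (inj₂ (inj₂ refl)) = x∈p∪q⁺ (inj₂ (x∈p∪q⁺ (inj₂ (x∈p∪q⁺ (inj₂ (x∈⁅x⁆ c))))))

  ins-del : ∀ {p : Subset n} {x} → x ∈ p → p - x ⊕ x ≡ p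
  ins-del {p} {x} x∈p = ⊆-antisym (λ h → [ ∈-minus⁻ , (λ { refl → x∈p }) ]′ (∈-⊕⁻ h)) back
    where
    back : p ⊆ p - x ⊕ x
    back {v} v∈p with v ≟ x
    ... | yes refl = ∈-⊕ʳ
    ... | no v≢x = ∈-⊕ˡ (∈-minus⁺ v∈p v≢x)

  del-absent : ∀ {p : Subset n} {x} → x ∉ p → p - x ≡ p
  del-absent x∉p = ⊆-antisym ∈-minus⁻ (λ v∈p → ∈-minus⁺ v∈p (λ { refl → x∉p v∈p }))

  del-ins₂ : ∀ {p : Subset n} {y z} → y ∉ p → z ∉ p → p ⊕ y ⊕ z - y - z ≡ p
  del-ins₂ {p} {y} {z} y∉p z∉p = ⊆-antisym out (λ v∈p → ∈-minus⁺ (∈-minus⁺ (∈-⊕ˡ (∈-⊕ˡ v∈p))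
                                     (λ { refl → y∉p v∈p })) (λ { refl → z∉p v∈p }))
    where
    out : p ⊕ y ⊕ z - y - z ⊆ p
    out h with ∈-⊕⁻ (∈-minus⁻ (∈-minus⁻ h))
    ... | inj₂ refl = ⊥-elim (∈-minus-≢ h refl)
    ... | inj₁ h′ = [ id , (λ { refl → ⊥-elim (∈-minus-≢ (∈-minus⁻ h) refl) }) ]′ (∈-⊕⁻ h′)

  card-minus : ∀ {p : Subset n} {x} → x ∈ p → ∣ p ∣ ≡ suc ∣ p - x ∣
  card-minus {p} {x} x∈p = begin
    ∣ p ∣           ≡⟨ cong ∣_∣ (sym (ins-del x∈p)) ⟩
    ∣ p - x ⊕ x ∣   ≡⟨ card-⊕ (p - x) (x∉p-x p x) ⟩
    suc ∣ p - x ∣   ∎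
    where open ≡-Reasoning

  card-⊕₂ : ∀ {p : Subset n} {y z} → y ∉ p → z ∉ p → y ≢ z → ∣ p ⊕ y ⊕ z ∣ ≡ suc (suc ∣ p ∣)
  card-⊕₂ {p} {y} y∉p z∉p y≢z =
    trans (card-⊕ (p ⊕ y) (∉-⊕ z∉p (y≢z ∘ sym))) (cong suc (card-⊕ p y∉p))

  card-minus₂ : ∀ {p : Subset n} {y z} → y ∈ p → z ∈ p - y → ∣ p ∣ ≡ suc (suc ∣ p - y - z ∣)
  card-minus₂ y∈p z∈p-y = trans (card-minus y∈p) (cong suc (card-minus z∈p-y))

  one-element : ∀ {p : Subset n} {y w} → ∣ p ∣ ≡ 1 → y ∈ p → w ∈ p → w ≡ y
  one-element {p} {y} {w} size y∈p w∈p with w ≟ y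
  ... | yes w≡y = w≡y
  ... | no w≢y = case trans (sym size) (trans (card-minus y∈p) (cong suc (card-minus (∈-minus⁺ w∈p w≢y)))) of λ ()

  two-elements : ∀ {p : Subset n} {y z w} → ∣ p ∣ ≡ 2 → y ∈ p → z ∈ p → y ≢ z → w ∈ p → w ≡ y ⊎ w ≡ z
  two-elements {p} {y} {z} {w} size y∈p z∈p y≢z w∈p with w ≟ y | w ≟ z
  ... | yes w≡y | _ = inj₁ w≡y
  ... | no _ | yes w≡z = inj₂ w≡z
  ... | no w≢y | no w≢z = case trans (sym size) (trans (card-minus₂ y∈p (∈-minus⁺ z∈p (y≢z ∘ sym)))
                                (cong (2 +_) (card-minus (∈-minus⁺ (∈-minus⁺ w∈p w≢y) w≢z)))) of λ ()

module _ {n : ℕ} (G : SimpleGraph n) where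

  ∈-nbhd : ∀ {V v w} → w ∈ V → Adj G v w → w ∈ nbhd G V v
  ∈-nbhd {V} {v} {w} w∈V v~w = lookup⇒[]= w _ (trans (lookup∘tabulate _ w)
    (cong₂ _∧_ ([]=⇒lookup w∈V) (trans (isYes≗does (adj? G v w)) (dec-true (adj? G v w) v~w))))

  neighbour-of-degree-one : ∀ {V v y w} → deg G V v ≡ 1 → y ∈ V → Adj G v y →
    w ∈ V → Adj G v w → w ≡ y
  neighbour-of-degree-one d y∈V v~y w∈V v~w = one-element d (∈-nbhd y∈V v~y) (∈-nbhd w∈V v~w)

  neighbours-of-degree-two : ∀ {V v y z w} → deg G V v ≡ 2 → y ∈ V → Adj G v y → z ∈ V → Adj G v z →
    y ≢ z → w ∈ V → Adj G v w → w ≡ y ⊎ w ≡ z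
  neighbours-of-degree-two d y∈V v~y z∈V v~z y≢z w∈V v~w =
    two-elements d (∈-nbhd y∈V v~y) (∈-nbhd z∈V v~z) y≢z (∈-nbhd w∈V v~w)

  OP : Subset n → Subset n → Set
  OP = IsOpenPacking G

  Separated : Subset n → Fin n → Fin n → Set
  Separated W u v = ∀ w → w ∈ W → Adj G u w → Adj G v w → ⊥

  separated : ∀ {W S u v} → OP W S → u ∈ S → v ∈ S → u ≢ v → Separated W u v
  separated (_ , disjoint) u∈S v∈S u≢v w w∈W u~w v~w = disjoint _ _ u∈S v∈S u≢v w w∈W (u~w , v~w)

  packing-mono : ∀ {V W S S′} → OP V S → S′ ⊆ S → S′ ⊆ W → W ⊆ V → OP W S′
  packing-mono (_ , disjoint) S′⊆S S′⊆W W⊆V =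
    S′⊆W , λ u v u∈ v∈ u≢v w w∈W → disjoint u v (S′⊆S u∈) (S′⊆S v∈) u≢v w (W⊆V w∈W)

  packing-minus : ∀ {W S} y → OP W S → OP W (S - y)
  packing-minus y S-pack = packing-mono S-pack ∈-minus⁻ (proj₁ S-pack ∘ ∈-minus⁻) id

  packing-add : ∀ {W S u} → OP W S → u ∈ W → (∀ s → s ∈ S → s ≢ u → Separated W s u) → OP W (S ⊕ u)
  packing-add {W} {S} {u} (S⊆W , disjoint) u∈W sep = ⊆W , disjoint′
    where
    ⊆W : S ⊕ u ⊆ W
    ⊆W h = [ S⊆W , (λ { refl → u∈W }) ]′ (∈-⊕⁻ h)
    disjoint′ : ∀ s t → s ∈ S ⊕ u → t ∈ S ⊕ u → s ≢ t → ∀ w → w ∈ W → ¬ (Adj G s w × Adj G t w)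
    disjoint′ s t s∈ t∈ s≢t w w∈W (s~w , t~w) with ∈-⊕⁻ s∈ | ∈-⊕⁻ t∈
    ... | inj₁ s∈S | inj₁ t∈S = disjoint s t s∈S t∈S s≢t w w∈W (s~w , t~w)
    ... | inj₁ s∈S | inj₂ refl = sep s s∈S s≢t w w∈W s~w t~w
    ... | inj₂ refl | inj₁ t∈S = sep t t∈S (s≢t ∘ sym) w w∈W t~w s~w
    ... | inj₂ refl | inj₂ refl = s≢t refl

  -- being an open packing is decidable, so the final case split is constructive
  packing-dec : ∀ W S → Dec (OP W S)
  packing-dec W S = (S ⊆? W) ×-dec all? λ u → all? λ v → (u ∈? S) →-dec (v ∈? S) →-dec ¬? (u ≟ v) →-dec
    all? λ w → (w ∈? W) →-dec ¬? (adj? G u w ×-dec adj? G v w)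

  module Avoiding (x : Fin n) where

    record UniqueMaxAvoiding (W R : Subset n) : Set where
      field
        packing : OP W R
        avoids  : x ∉ R
        largest : ∀ S → OP W S → x ∉ S → ∣ S ∣ ≤ ∣ R ∣
        unique  : ∀ S → OP W S → x ∉ S → ∣ R ∣ ≤ ∣ S ∣ → S ≡ R
    open UniqueMaxAvoiding public

    from-unique : ∀ {W U} → IsUniqueMaxOP G W U → x ∉ U → UniqueMaxAvoiding W U
    from-unique ((U-pack , U-max) , U-unique) x∉U = record
      { packing = U-pack
      ; avoids  = x∉U
      ; largest = λ S S-pack _ → U-max S S-pack
      ; unique  = λ S S-pack _ U≤S → U-unique S (S-pack , λ S′ S′-pack → ≤-trans (U-max S′ S′-pack) U≤S)
      }

    add-centre : ∀ {W R} → UniqueMaxAvoiding W R → OP W (R ⊕ x) → IsUniqueMaxOP G W (R ⊕ x)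
    add-centre {W} {R} R-max Rx-pack = (Rx-pack , largest-all) , unique-all
      where
      size : ∣ R ⊕ x ∣ ≡ suc ∣ R ∣
      size = card-⊕ R (avoids R-max)
      largest-without-x : ∀ {S} → OP W S → x ∈ S → ∣ S - x ∣ ≤ ∣ R ∣
      largest-without-x S-pack x∈S = largest R-max _ (packing-minus x S-pack) (λ h → ∈-minus-≢ h refl)
      largest-all : ∀ S → OP W S → ∣ S ∣ ≤ ∣ R ⊕ x ∣
      largest-all S S-pack with x ∈? S
      ... | yes x∈S = subst₂ _≤_ (sym (card-minus x∈S)) (sym size) (s≤s (largest-without-x S-pack x∈S))
      ... | no x∉S = ≤-trans (largest R-max S S-pack x∉S) (≤-trans (n≤1+n _) (≤-reflexive (sym size)))
      unique-all : ∀ S → IsMaxOpenPacking G W S → S ≡ R ⊕ x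
      unique-all S (S-pack , S-max) with x ∈? S | subst₂ _≤_ size refl (S-max (R ⊕ x) Rx-pack)
      ... | no x∉S | Rx≤S = ⊥-elim (1+n≰n (≤-trans Rx≤S (largest R-max S S-pack x∉S)))
      ... | yes x∈S | Rx≤S = trans (sym (ins-del x∈S)) (cong (_⊕ x) S-x≡R)
        where
        S-x≡R : S - x ≡ R
        S-x≡R = unique R-max _ (packing-minus x S-pack) (λ h → ∈-minus-≢ h refl)
                  (s≤s⁻¹ (subst₂ _≤_ refl (card-minus x∈S) Rx≤S))

    only-one-below : ∀ {W R} → UniqueMaxAvoiding W R → ExactlyOneOPMinusOne G W (R ⊕ x) x
    only-one-below {R = R} R-max =
      R , (packing R-max , R≡ , avoids R-max) ,
      λ S S-pack S≡ x∉S → unique R-max S S-pack x∉S (≤-reflexive (trans R≡ (sym S≡)))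
      where
      R≡ : ∣ R ∣ ≡ ∣ R ⊕ x ∣ ∸ 1
      R≡ = sym (cong (_∸ 1) (card-⊕ R (avoids R-max)))

module PendantPath {n : ℕ} (G : SimpleGraph n) (V : Subset n) (x : Fin n)
  (x∈V : x ∈ V) (deg-x : 3 ≤ deg G V x)
  (a b c : Fin n) (a∈V : a ∈ V) (b∈V : b ∈ V) (c∈V : c ∈ V)
  (x~a : Adj G x a) (a~b : Adj G a b) (b~c : Adj G b c)
  (deg-a : deg G V a ≡ 2) (deg-b : deg G V b ≡ 2) (deg-c : deg G V c ≡ 1) where

  open Avoiding G x

  centre-degree : ∀ {v} → deg G V v ≤ 2 → x ≢ v
  centre-degree low refl = <⇒≱ (s≤s low) deg-x

  x≢a : x ≢ a
  x≢a refl = adj-irrefl G x~a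

  x≢b : x ≢ b
  x≢b = centre-degree (≤-reflexive deg-b)

  x≢c : x ≢ c
  x≢c = centre-degree (≤-trans (≤-reflexive deg-c) (n≤1+n 1))

  a≢b : a ≢ b
  a≢b refl = adj-irrefl G a~b

  b≢c : b ≢ c
  b≢c refl = adj-irrefl G b~c

  a≢c : a ≢ c
  a≢c refl = case trans (sym deg-a) deg-c of λ ()

  neighbours-a : ∀ {w} → w ∈ V → Adj G a w → w ≡ x ⊎ w ≡ b
  neighbours-a = neighbours-of-degree-two G deg-a x∈V (adj-sym G x~a) b∈V a~b x≢b

  neighbours-b : ∀ {w} → w ∈ V → Adj G b w → w ≡ a ⊎ w ≡ c
  neighbours-b = neighbours-of-degree-two G deg-b a∈V (adj-sym G a~b) c∈V b~c a≢c

  neighbours-c : ∀ {w} → w ∈ V → Adj G c w → w ≡ b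
  neighbours-c = neighbour-of-degree-one G deg-c b∈V (adj-sym G b~c)

  x≁b : ¬ Adj G x b
  x≁b x~b = [ x≢a , x≢c ]′ (neighbours-b x∈V (adj-sym G x~b))

  x≁c : ¬ Adj G x c
  x≁c x~c = x≢b (neighbours-c x∈V (adj-sym G x~c))

  add-middle : ∀ {W S} → W ⊆ V → b ∈ W → OP G W S → x ∉ S → OP G W (S ⊕ b)
  add-middle {W} {S} W⊆V b∈W S-pack x∉S = packing-add G S-pack b∈W sep
    where
    sep : ∀ s → s ∈ S → s ≢ b → Separated G W s b
    sep s s∈S s≢b w w∈W s~w b~w with neighbours-b (W⊆V w∈W) b~w
    ... | inj₁ refl = [ (λ { refl → x∉S s∈S }) , s≢b ]′
                        (neighbours-a (W⊆V (proj₁ S-pack s∈S)) (adj-sym G s~w))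
    ... | inj₂ refl = s≢b (neighbours-c (W⊆V (proj₁ S-pack s∈S)) (adj-sym G s~w))

  add-end : ∀ {W S} → W ⊆ V → c ∈ W → OP G W S → a ∉ S → OP G W (S ⊕ c)
  add-end {W} {S} W⊆V c∈W S-pack a∉S = packing-add G S-pack c∈W sep
    where
    sep : ∀ s → s ∈ S → s ≢ c → Separated G W s c
    sep s s∈S s≢c w w∈W s~w c~w with neighbours-c (W⊆V w∈W) c~w
    ... | refl = [ (λ { refl → a∉S s∈S }) , s≢c ]′
                   (neighbours-b (W⊆V (proj₁ S-pack s∈S)) (adj-sym G s~w))

  add-path : ∀ {W S} → W ⊆ V → b ∈ W → c ∈ W → OP G W S → x ∉ S → a ∉ S → OP G W (S ⊕ b ⊕ c)
  add-path W⊆V b∈W c∈W S-pack x∉S a∉S =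
    add-end W⊆V c∈W (add-middle W⊆V b∈W S-pack x∉S) (∉-⊕ a∉S a≢b)

  -- b is a common neighbour of a and c, and a of x and b
  middle-excluded : ∀ {W S} → a ∈ W → OP G W S → x ∈ S → b ∉ S
  middle-excluded a∈W S-pack x∈S b∈S = separated G S-pack x∈S b∈S x≢b _ a∈W x~a (adj-sym G a~b)

  ends-exclusive : ∀ {W S} → b ∈ W → OP G W S → a ∈ S → c ∉ S
  ends-exclusive b∈W S-pack a∈S c∈S = separated G S-pack a∈S c∈S a≢c _ b∈W a~b (adj-sym G b~c)

  module Within (W : Subset n) (W⊆V : W ⊆ V)
    (x∈W : x ∈ W) (a∈W : a ∈ W) (b∈W : b ∈ W) (c∈W : c ∈ W) where

    W⁻ : Subset n
    W⁻ = W - a - b - c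

    W⁻⊆W : W⁻ ⊆ W
    W⁻⊆W = proj₁ ∘ ∈-minus₃⁻

    x∈W⁻ : x ∈ W⁻
    x∈W⁻ = ∈-minus₃⁺ x∈W x≢a x≢b x≢c

    a∉W⁻ : a ∉ W⁻
    a∉W⁻ h = proj₁ (proj₂ (∈-minus₃⁻ h)) refl

    b∉W⁻ : b ∉ W⁻
    b∉W⁻ h = proj₁ (proj₂ (proj₂ (∈-minus₃⁻ h))) refl

    c∉W⁻ : c ∉ W⁻
    c∉W⁻ h = proj₂ (proj₂ (proj₂ (∈-minus₃⁻ h))) refl

    a-isolated : ∀ {u} → u ∈ W⁻ → u ≢ x → ¬ Adj G u a
    a-isolated u∈ u≢x u~a with ∈-minus₃⁻ u∈
    ... | u∈W , _ , u≢b , _ = [ u≢x , u≢b ]′ (neighbours-a (W⊆V u∈W) (adj-sym G u~a))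

    b-isolated : ∀ {u} → u ∈ W⁻ → ¬ Adj G u b
    b-isolated u∈ u~b with ∈-minus₃⁻ u∈
    ... | u∈W , u≢a , _ , u≢c = [ u≢a , u≢c ]′ (neighbours-b (W⊆V u∈W) (adj-sym G u~b))

    c-isolated : ∀ {u} → u ∈ W⁻ → ¬ Adj G u c
    c-isolated u∈ u~c with ∈-minus₃⁻ u∈
    ... | u∈W , _ , u≢b , _ = u≢b (neighbours-c (W⊆V u∈W) (adj-sym G u~c))

    append : AppendP3 G W⁻ x W
    append = a , b , c , x∈W⁻ , a∉W⁻ , b∉W⁻ , c∉W⁻
      , a≢b , b≢c , a≢c , split₃ a∈W b∈W c∈W , x~a , a~b , b~c
      , (λ a~c → a≢b (neighbours-c a∈V (adj-sym G a~c)))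
      , (λ _ → a-isolated) , (λ _ → b-isolated) , (λ _ → c-isolated)

    widen : ∀ {S} → OP G W⁻ S → x ∉ S → OP G W S
    widen (S⊆W⁻ , disjoint) x∉S = W⁻⊆W ∘ S⊆W⁻ , disjoint′
      where
      disjoint′ : ∀ u v → u ∈ _ → v ∈ _ → u ≢ v → ∀ w → w ∈ W → ¬ (Adj G u w × Adj G v w)
      disjoint′ u v u∈S v∈S u≢v w w∈W (u~w , v~w) with minus₃-cases a b c w∈W
      ... | inj₁ w∈W⁻ = disjoint u v u∈S v∈S u≢v w w∈W⁻ (u~w , v~w)
      ... | inj₂ (inj₁ refl) = a-isolated (S⊆W⁻ u∈S) (λ { refl → x∉S u∈S }) u~w
      ... | inj₂ (inj₂ (inj₁ refl)) = b-isolated (S⊆W⁻ u∈S) u~w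
      ... | inj₂ (inj₂ (inj₂ refl)) = c-isolated (S⊆W⁻ u∈S) u~w

    lift : ∀ {S} → OP G W⁻ S → x ∉ S → OP G W (S ⊕ b ⊕ c)
    lift S-pack x∉S = add-path W⊆V b∈W c∈W (widen S-pack x∉S) x∉S (a∉W⁻ ∘ proj₁ S-pack)

    lift-size : ∀ {S} → S ⊆ W⁻ → ∣ S ⊕ b ⊕ c ∣ ≡ suc (suc ∣ S ∣)
    lift-size S⊆W⁻ = card-⊕₂ (b∉W⁻ ∘ S⊆W⁻) (c∉W⁻ ∘ S⊆W⁻) b≢c

    x∉lift : ∀ {S} → x ∉ S → x ∉ S ⊕ b ⊕ c
    x∉lift x∉S = ∉-⊕ (∉-⊕ x∉S x≢b) x≢c

    -- trading x and a for b and c does not shrink a packing containing x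
    exchange : ∀ {S} → OP G W S → x ∈ S →
      ∃[ S† ] (OP G W S† × x ∉ S† × ∣ S ∣ ≤ ∣ S† ∣ × S† - b - c ⊆ S)
    exchange {S} S-pack x∈S =
      S₀ ⊕ b ⊕ c , add-path W⊆V b∈W c∈W S₀-pack x∉S₀ a∉S₀ , x∉lift x∉S₀ , size , back
      where
      S₀ : Subset n
      S₀ = S - x - a
      S₀-pack : OP G W S₀
      S₀-pack = packing-minus G a (packing-minus G x S-pack)
      x∉S₀ : x ∉ S₀
      x∉S₀ h = ∈-minus-≢ (∈-minus⁻ h) refl
      a∉S₀ : a ∉ S₀
      a∉S₀ h = ∈-minus-≢ h refl
      b∉S₀ : b ∉ S₀
      b∉S₀ = middle-excluded a∈W S-pack x∈S ∘ ∈-minus⁻ ∘ ∈-minus⁻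
      size : ∣ S ∣ ≤ ∣ S₀ ⊕ b ⊕ c ∣
      size with a ∈? S - x
      ... | yes a∈S-x = ≤-reflexive (trans (card-minus₂ x∈S a∈S-x) (sym (card-⊕₂ b∉S₀ c∉S₀ b≢c)))
        where
        c∉S₀ : c ∉ S₀
        c∉S₀ = ends-exclusive b∈W S-pack (∈-minus⁻ a∈S-x) ∘ ∈-minus⁻ ∘ ∈-minus⁻
      ... | no a∉S-x = begin
        ∣ S ∣            ≡⟨ card-minus x∈S ⟩
        suc ∣ S - x ∣    ≡⟨ cong (suc ∘ ∣_∣) (sym (del-absent a∉S-x)) ⟩
        suc ∣ S₀ ∣       ≡⟨ sym (card-⊕ S₀ b∉S₀) ⟩
        ∣ S₀ ⊕ b ∣       ≤⟨ ∣p∣≤∣p∪q∣ (S₀ ⊕ b) ⁅ c ⁆ ⟩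
        ∣ S₀ ⊕ b ⊕ c ∣   ∎
        where open ≤-Reasoning
      back : S₀ ⊕ b ⊕ c - b - c ⊆ S
      back h with ∈-⊕⁻ (∈-minus⁻ (∈-minus⁻ h))
      ... | inj₂ refl = ⊥-elim (∈-minus-≢ h refl)
      ... | inj₁ h′ = [ ∈-minus⁻ ∘ ∈-minus⁻ , (λ { refl → ⊥-elim (∈-minus-≢ (∈-minus⁻ h) refl) }) ]′
                        (∈-⊕⁻ h′)

    module _ {R : Subset n} (R-max : UniqueMaxAvoiding W R) where

      private
        R-pack : OP G W R
        R-pack = packing R-max

        R⊆W : R ⊆ W
        R⊆W = proj₁ R-pack

      -- if a ∈ R, then R - a + b + c would be a different x-free packing, no smaller
      start-excluded : a ∉ R
      start-excluded a∈R = a∉R′ (subst (a ∈_) (sym R′≡R) a∈R)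
        where
        R′ : Subset n
        R′ = R - a ⊕ b ⊕ c
        c∉R-a⊕b : c ∉ R - a ⊕ b
        c∉R-a⊕b = ∉-⊕ (ends-exclusive b∈W R-pack a∈R ∘ ∈-minus⁻) (b≢c ∘ sym)
        R≤R′ : ∣ R ∣ ≤ ∣ R′ ∣
        R≤R′ = begin
          ∣ R ∣              ≡⟨ card-minus a∈R ⟩
          suc ∣ R - a ∣      ≤⟨ s≤s (∣p∣≤∣p∪q∣ (R - a) ⁅ b ⁆) ⟩
          suc ∣ R - a ⊕ b ∣  ≡⟨ sym (card-⊕ (R - a ⊕ b) c∉R-a⊕b) ⟩
          ∣ R′ ∣             ∎
          where open ≤-Reasoning
        a∉R-a : a ∉ R - a
        a∉R-a h = ∈-minus-≢ h refl
        R′≡R : R′ ≡ R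
        R′≡R = unique R-max R′
          (add-path W⊆V b∈W c∈W (packing-minus G a R-pack) (avoids R-max ∘ ∈-minus⁻) a∉R-a)
          (x∉lift (avoids R-max ∘ ∈-minus⁻)) R≤R′
        a∉R′ : a ∉ R′
        a∉R′ = ∉-⊕ (∉-⊕ a∉R-a a≢b) a≢c

      -- adding b and c to R gives an x-free packing, so they already belong to R
      absorbs-path : R ⊕ b ⊕ c ≡ R
      absorbs-path = unique R-max _ (add-path W⊆V b∈W c∈W R-pack (avoids R-max) start-excluded)
        (x∉lift (avoids R-max)) (p⊆q⇒∣p∣≤∣q∣ {p = R} {q = R ⊕ b ⊕ c} (∈-⊕ˡ ∘ ∈-⊕ˡ))

      b∈R : b ∈ R
      b∈R = subst (b ∈_) absorbs-path (∈-⊕ˡ ∈-⊕ʳ)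

      c∈R : c ∈ R
      c∈R = subst (c ∈_) absorbs-path ∈-⊕ʳ

      restrict : UniqueMaxAvoiding W⁻ (R - b - c)
      restrict = record
        { packing = packing-mono G R-pack (∈-minus⁻ ∘ ∈-minus⁻) core⊆W⁻ W⁻⊆W
        ; avoids  = avoids R-max ∘ ∈-minus⁻ ∘ ∈-minus⁻
        ; largest = λ S S-pack x∉S → s≤s⁻¹ (s≤s⁻¹ (subst₂ _≤_ (lift-size (proj₁ S-pack)) R-size
                                       (largest R-max _ (lift S-pack x∉S) (x∉lift x∉S))))
        ; unique  = λ S S-pack x∉S le → trans (sym (del-ins₂ (b∉W⁻ ∘ proj₁ S-pack) (c∉W⁻ ∘ proj₁ S-pack)))
                      (cong (λ T → T - b - c) (unique R-max _ (lift S-pack x∉S) (x∉lift x∉S)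
                        (subst₂ _≤_ (sym R-size) (sym (lift-size (proj₁ S-pack))) (s≤s (s≤s le)))))
        }
        where
        core⊆W⁻ : R - b - c ⊆ W⁻
        core⊆W⁻ {v} h = ∈-minus₃⁺ (R⊆W v∈R) (λ { refl → start-excluded v∈R })
                          (∈-minus-≢ (∈-minus⁻ h)) (∈-minus-≢ h)
          where
          v∈R : v ∈ R
          v∈R = ∈-minus⁻ (∈-minus⁻ h)
        R-size : ∣ R ∣ ≡ suc (suc ∣ R - b - c ∣)
        R-size = card-minus₂ b∈R (∈-minus⁺ c∈R (b≢c ∘ sym))

      -- R contains a neighbour of x: otherwise R - c + a is a different x-free packing
      centre-has-neighbour : ∃[ y ] (y ∈ W × Adj G x y × y ∈ R)
      centre-has-neighbour with any? (λ y → y ∈? W ×-dec adj? G x y ×-dec y ∈? R)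
      ... | yes found = found
      ... | no none = ⊥-elim (start-excluded (subst (a ∈_) R′≡R ∈-⊕ʳ))
        where
        sep : ∀ s → s ∈ R - c → s ≢ a → Separated G W s a
        sep s s∈ s≢a w w∈W s~w a~w with neighbours-a (W⊆V w∈W) a~w
        ... | inj₁ refl = none (s , R⊆W (∈-minus⁻ s∈) , adj-sym G s~w , ∈-minus⁻ s∈)
        ... | inj₂ refl = [ s≢a , ∈-minus-≢ s∈ ]′ (neighbours-b (W⊆V (R⊆W (∈-minus⁻ s∈))) (adj-sym G s~w))
        R′≡R : R - c ⊕ a ≡ R
        R′≡R = unique R-max _ (packing-add G (packing-minus G c R-pack) a∈W sep)
          (∉-⊕ (avoids R-max ∘ ∈-minus⁻) x≢a)
          (≤-reflexive (trans (card-minus c∈R)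
            (sym (card-⊕ (R - c) (start-excluded ∘ ∈-minus⁻)))))

      dichotomy : IsUniqueMaxOP G W R ⊎ OP G W⁻ (R - b - c ⊕ x)
      dichotomy with packing-dec G W⁻ (R - b - c ⊕ x)
      ... | yes core-pack = inj₂ core-pack
      ... | no ¬core-pack = inj₁ ((R-pack , largest-all) , unique-all)
        where
        largest-all : ∀ S → OP G W S → ∣ S ∣ ≤ ∣ R ∣
        largest-all S S-pack with x ∈? S
        ... | no x∉S = largest R-max S S-pack x∉S
        ... | yes x∈S with exchange S-pack x∈S
        ... | S† , S†-pack , x∉S† , S≤S† , _ = ≤-trans S≤S† (largest R-max S† S†-pack x∉S†)
        unique-all : ∀ S → IsMaxOpenPacking G W S → S ≡ R
        unique-all S (S-pack , S-max) with x ∈? S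
        ... | no x∉S = unique R-max S S-pack x∉S (S-max R R-pack)
        ... | yes x∈S with exchange S-pack x∈S
        ... | S† , S†-pack , x∉S† , S≤S† , S†-core⊆S =
          ⊥-elim (¬core-pack (packing-mono G S-pack core⊆S core⊆W⁻ W⁻⊆W))
          where
          S†≡R : S† ≡ R
          S†≡R = unique R-max S† S†-pack x∉S† (≤-trans (S-max R R-pack) S≤S†)
          core⊆S : R - b - c ⊕ x ⊆ S
          core⊆S h = [ S†-core⊆S ∘ subst (λ T → _ ∈ T - b - c) (sym S†≡R) , (λ { refl → x∈S }) ]′
                       (∈-⊕⁻ h)
          core⊆W⁻ : R - b - c ⊕ x ⊆ W⁻
          core⊆W⁻ h = [ proj₁ (packing restrict) , (λ { refl → x∈W⁻ }) ]′ (∈-⊕⁻ h)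

module TwoPendantPaths {n : ℕ} (G : SimpleGraph n) (V : Subset n) (x : Fin n)
  (x∈V : x ∈ V) (deg-x : 3 ≤ deg G V x) (U : Subset n) (U-unique : IsUniqueMaxOP G V U)
  (a b c a' b' c' : Fin n)
  (a∈V : a ∈ V) (b∈V : b ∈ V) (c∈V : c ∈ V) (a'∈V : a' ∈ V) (b'∈V : b' ∈ V) (c'∈V : c' ∈ V)
  (x~a : Adj G x a) (a~b : Adj G a b) (b~c : Adj G b c)
  (x~a' : Adj G x a') (a'~b' : Adj G a' b') (b'~c' : Adj G b' c')
  (a≢a' : a ≢ a')
  (deg-a : deg G V a ≡ 2) (deg-a' : deg G V a' ≡ 2) (deg-b : deg G V b ≡ 2) (deg-b' : deg G V b' ≡ 2)
  (deg-c : deg G V c ≡ 1) (deg-c' : deg G V c' ≡ 1) where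

  open Avoiding G x

  module P₁ = PendantPath G V x x∈V deg-x a b c a∈V b∈V c∈V x~a a~b b~c deg-a deg-b deg-c
  module P₂ = PendantPath G V x x∈V deg-x a' b' c' a'∈V b'∈V c'∈V x~a' a'~b' b'~c' deg-a' deg-b' deg-c'

  a'≢b : a' ≢ b
  a'≢b refl = P₁.x≁b x~a'

  a'≢c : a' ≢ c
  a'≢c refl = P₁.x≁c x~a'

  b'≢a : b' ≢ a
  b'≢a refl = P₂.x≁b x~a

  c'≢a : c' ≢ a
  c'≢a refl = P₂.x≁c x~a

  b'≢b : b' ≢ b
  b'≢b refl = [ a≢a' ∘ sym , a'≢c ]′ (P₁.neighbours-b a'∈V (adj-sym G a'~b'))

  b'≢c : b' ≢ c
  b'≢c refl = a'≢b (P₁.neighbours-c a'∈V (adj-sym G a'~b'))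

  c'≢b : c' ≢ b
  c'≢b refl = [ b'≢a , b'≢c ]′ (P₁.neighbours-b b'∈V (adj-sym G b'~c'))

  c'≢c : c' ≢ c
  c'≢c refl = b'≢b (P₁.neighbours-c b'∈V (adj-sym G b'~c'))

  -- a maximum packing of G[V] avoids x: otherwise U - x + b + b' is larger
  centre-avoided : x ∉ U
  centre-avoided x∈U = 1+n≰n (≤-trans (≤-reflexive (sym bigger-size)) (U-max _ bigger-pack))
    where
    U-pack : OP G V U
    U-pack = proj₁ (proj₁ U-unique)
    U-max : ∀ S → OP G V S → ∣ S ∣ ≤ ∣ U ∣
    U-max = proj₂ (proj₁ U-unique)
    x∉U-x : x ∉ U - x
    x∉U-x h = ∈-minus-≢ h refl
    bigger-pack : OP G V (U - x ⊕ b ⊕ b')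
    bigger-pack = P₂.add-middle id b'∈V (P₁.add-middle id b∈V (packing-minus G x U-pack) x∉U-x)
                    (∉-⊕ x∉U-x P₁.x≢b)
    bigger-size : ∣ U - x ⊕ b ⊕ b' ∣ ≡ suc ∣ U ∣
    bigger-size = trans (card-⊕₂ (P₁.middle-excluded a∈V U-pack x∈U ∘ ∈-minus⁻)
                                 (P₂.middle-excluded a'∈V U-pack x∈U ∘ ∈-minus⁻) (b'≢b ∘ sym))
                        (cong suc (sym (card-minus x∈U)))

  T₁ T : Subset n
  T₁ = V - a - b - c
  T = T₁ - a' - b' - c'

  module W₁ = P₁.Within V id x∈V a∈V b∈V c∈V
  module W₂ = P₂.Within T₁ W₁.W⁻⊆W W₁.x∈W⁻
    (∈-minus₃⁺ a'∈V (a≢a' ∘ sym) a'≢b a'≢c) (∈-minus₃⁺ b'∈V b'≢a b'≢b b'≢c)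
    (∈-minus₃⁺ c'∈V c'≢a c'≢b c'≢c)

  U₁ S₀ : Subset n
  U₁ = U - b - c
  S₀ = U₁ - b' - c'

  U₁-max : UniqueMaxAvoiding T₁ U₁
  U₁-max = W₁.restrict (from-unique U-unique centre-avoided)

  S₀-max : UniqueMaxAvoiding T S₀
  S₀-max = W₂.restrict U₁-max

  -- a neighbour of x in U₁ lies off the second path, hence in S₀
  neighbour-in-S₀ : ∃[ y ] (y ∈ T × Adj G x y × y ∈ S₀)
  neighbour-in-S₀ with W₂.centre-has-neighbour U₁-max
  ... | y , _ , x~y , y∈U₁ = y , proj₁ (packing S₀-max) y∈S₀ , x~y , y∈S₀
    where
    y∈S₀ : y ∈ S₀
    y∈S₀ = ∈-minus⁺ (∈-minus⁺ y∈U₁ (λ { refl → P₂.x≁b x~y })) (λ { refl → P₂.x≁c x~y })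

  Conclusion : Set
  Conclusion = (HasUniqueMaxOP G T ⊎ HasUniqueMaxOP G T₁) × (Operation3 G T x V ⊎ Operation2 G T₁ x V)

  operation-2 : IsUniqueMaxOP G T₁ U₁ → Conclusion
  operation-2 U₁-unique =
    inj₂ (U₁ , U₁-unique) ,
    inj₂ (U₁ , U₁-unique , avoids U₁-max , W₂.centre-has-neighbour U₁-max , W₁.append)

  operation-3 : OP G T (S₀ ⊕ x) → Conclusion
  operation-3 core-pack =
    inj₁ (S₀ ⊕ x , core-unique) ,
    inj₁ (S₀ ⊕ x , core-unique , ∈-⊕ʳ , in-core neighbour-in-S₀ ,
          only-one-below S₀-max , T₁ , W₂.append , W₁.append)
    where
    core-unique : IsUniqueMaxOP G T (S₀ ⊕ x)
    core-unique = add-centre S₀-max core-pack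
    in-core : ∃[ y ] (y ∈ T × Adj G x y × y ∈ S₀) → ∃[ y ] (y ∈ T × Adj G x y × y ∈ S₀ ⊕ x)
    in-core (y , y∈T , x~y , y∈S₀) = y , y∈T , x~y , ∈-⊕ˡ y∈S₀

mainTheorem20 : {n : ℕ} (G : SimpleGraph n) (V' : Subset n) (x a b c a' b' c' : Fin n) →
    IsTree G V' → HasUniqueMaxOP G V' → MaxDeg≥3 G V' → IsLeafOfL G V' x →
    a ∈ V' → b ∈ V' → c ∈ V' → a' ∈ V' → b' ∈ V' → c' ∈ V' →
    Adj G x a → Adj G a b → Adj G b c → Adj G x a' → Adj G a' b' → Adj G b' c' →
    a ≢ a' →
    deg G V' a ≡ 2 → deg G V' a' ≡ 2 → deg G V' b ≡ 2 → deg G V' b' ≡ 2 →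
    deg G V' c ≡ 1 → deg G V' c' ≡ 1 →
    (HasUniqueMaxOP G (V' - a - b - c - a' - b' - c')
      ⊎ HasUniqueMaxOP G (V' - a - b - c))
    × (Operation3 G (V' - a - b - c - a' - b' - c') x V'
      ⊎ Operation2 G (V' - a - b - c) x V')
mainTheorem20 G V' x a b c a' b' c' _ (U , U-unique) _ (x∈V' , deg-x , _)
  a∈ b∈ c∈ a'∈ b'∈ c'∈ x~a a~b b~c x~a' a'~b' b'~c' a≢a' deg-a deg-a' deg-b deg-b' deg-c deg-c' =
  [ operation-2 , operation-3 ]′ (W₂.dichotomy U₁-max)
  where
  open TwoPendantPaths G V' x x∈V' deg-x U U-unique a b c a' b' c' a∈ b∈ c∈ a'∈ b'∈ c'∈
    x~a a~b b~c x~a' a'~b' b'~c' a≢a' deg-a deg-a' deg-b deg-b' deg-c deg-c'
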